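{- Let $\mathcal{A}$ be a partial combinatory algebra and $H=\{\langle a,b\rangle : a,b\in\mathcal{A},\ ab\downarrow\}$. Then for every set $A\subseteq\mathcal{A}$ that is computably enumerable in $\mathcal{A}$ we have $A\le_m H$.
   Context: A pca $\mathcal{A}$ is a set with a partial, left-associative, strict application that is combinatory complete; equivalently it has $k,s$ with $kab=a$, $sab\downarrow$, $sabc\simeq ac(bc)$. Pairs are $\langle a,b\rangle=\lambda^*z.zab$ (combinatory abstraction). $A$ is computably enumerable in $\mathcal{A}$ if $A=\{a: ea\downarrow\}$ for some $e\in\mathcal{A}$. For $A,B\subseteq\mathcal{A}$, $A\le_m B$ means there is $f\in\mathcal{A}$ with $fa$ defined for every $a$ and $a\in A\iff fa\in B$ for all $a\in\mathcal{A}$. -}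

module Defs where

open import Data.Nat using (ℕ; suc)
open import Data.Fin using (Fin; zero; suc)
open import Data.Product using (Σ; ∃; ∃-syntax; _×_; _,_)
open import Function.Bundles using (_⇔_)
open import Relation.Binary.PropositionalEquality using (_≡_)

-- Partial application is given as a
-- functional graph relation  App a b c  ("a b is defined and equals c");
-- definedness  a b ↓  is  ∃ c. App a b c.  (Partiality is not assumed
-- decidable.)  Kleene equality  s a b c ≃ a c (b c)  is expressed as:
-- for every v, (s a b c ↓ with value v) iff (a c (b c) ↓ with value v).
record PCA : Set₁ where
  field
    Carrier    : Set
    App        : Carrier → Carrier → Carrier → Set
    functional : ∀ {a b c c'} → App a b c → App a b c' → c ≡ c'
    k s        : Carrier
    k-ax : ∀ a b → ∃[ ka ] (App k a ka × App ka b a)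
    s-def : ∀ a b → ∃[ sa ] ∃[ sab ] (App s a sa × App sa b sab)
    s-ax : ∀ {a b sa sab} → App s a sa → App sa b sab →
           ∀ c v → (App sab c v ⇔
                    (∃[ ac ] ∃[ bc ] (App a c ac × App b c bc × App ac bc v)))

module _ (𝒜 : PCA) where
  open PCA 𝒜

  _↓[_] : Carrier → Carrier → Set
  a ↓[ b ] = ∃[ c ] App a b c

  data Term (n : ℕ) : Set where
    var   : Fin n → Term n
    const : Carrier → Term n
    _∙_   : Term n → Term n → Term n

  data Eval : Term 0 → Carrier → Set where
    ev-const : ∀ {c} → Eval (const c) c
    ev-app   : ∀ {t u a b c} → Eval t a → Eval u b → App a b c → Eval (t ∙ u) c

  λ* : ∀ {n} → Term (suc n) → Term n
  λ* (var zero)    = (const s ∙ const k) ∙ const k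
  λ* (var (suc i)) = const k ∙ var i
  λ* (const c)     = const k ∙ const c
  λ* (t ∙ u)       = (const s ∙ λ* t) ∙ λ* u

  pairTerm : Carrier → Carrier → Term 0
  pairTerm a b = λ* ((var zero ∙ const a) ∙ const b)

  IsPair : Carrier → Carrier → Carrier → Set
  IsPair a b p = Eval (pairTerm a b) p

  H : Carrier → Set
  H p = ∃[ a ] ∃[ b ] (IsPair a b p × a ↓[ b ])

  CE : (Carrier → Set) → Set
  CE A = ∃[ e ] (∀ a → (A a ⇔ (e ↓[ a ])))

  _≤m_ : (Carrier → Set) → (Carrier → Set) → Set
  A ≤m B = ∃[ f ] ((∀ a → f ↓[ a ]) ×
                   (∀ a fa → App f a fa → (A a ⇔ B fa)))

module Submission where

-- If A = { a : e a ↓ }, the reduction sends a to the pair ⟨e,a⟩; then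
-- a ∈ A ⇔ e a ↓ ⇔ ⟨e,a⟩ ∈ H, where the last step needs that a pair
-- determines its components.

open import Defs
open import Data.Product using (∃-syntax; _×_; _,_)
open import Function.Bundles using (mk⇔; Equivalence)
open import Relation.Binary.PropositionalEquality using (_≡_; sym; subst; subst₂)

module Reduction (𝒜 : PCA) where
  open PCA 𝒜
  open Equivalence using (to; from)

  private variable
    a b c x y z v w ka sa sab ac bc : Carrier

  k-app : App k x ka → App ka z x
  k-app {x} {z = z} hka =
    let (_ , hka' , hka'z) = k-ax x z
    in subst (λ q → App q z x) (functional hka' hka) hka'z

  s-app : App s a sa → App sa b sab →
          App a c ac → App b c bc → App ac bc v → App sab c v
  s-app hs hsa ha hb hv = from (s-ax hs hsa _ _) (_ , _ , ha , hb , hv)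

  s-inv : App s a sa → App sa b sab → App sab c v →
          ∃[ ac ] ∃[ bc ] (App a c ac × App b c bc × App ac bc v)
  s-inv hs hsa h = to (s-ax hs hsa _ _) h

  s-k-k-identity : ∀ {sk i} → App s k sk → App sk k i → App i z z
  s-k-k-identity {z} hsk hi =
    let (kz , hkz , _) = k-ax z z
    in s-app hsk hi hkz hkz (k-app hkz)

  -- Unfolding λ*: ⟨x,y⟩ = s d (k y) with d = s i (k x) and i = s k k.
  -- pair-eval builds an evaluation of pairTerm from these steps; pair-app
  -- below reads them back off an arbitrary evaluation.
  pair-eval : ∀ {sk i si kx d sd ky p} →
              App s k sk → App sk k i → App s i si → App k x kx → App si kx d →
              App s d sd → App k y ky → App sd ky p → IsPair 𝒜 x y p
  pair-eval hsk hi hsi hkx hd hsd hky hp =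
    ev-app (ev-app ev-const
             (ev-app (ev-app ev-const
                       (ev-app (ev-app ev-const ev-const hsk) ev-const hi) hsi)
                     (ev-app ev-const ev-const hkx) hd) hsd)
           (ev-app ev-const ev-const hky) hp

  -- A pair applied to z behaves as z applied to its components:
  -- ⟨x,y⟩ z = d z (k y z) = (i z (k x z)) y = z x y.
  pair-app : ∀ {p zx} → IsPair 𝒜 x y p → App z x zx → App zx y w → App p z w
  pair-app (ev-app (ev-app ev-const
                     (ev-app (ev-app ev-const
                               (ev-app (ev-app ev-const ev-const hsk) ev-const hi) hsi)
                             (ev-app ev-const ev-const hkx) hd) hsd)
                   (ev-app ev-const ev-const hky) hp) hzx hw =
    s-app hsd hp
      (s-app hsi hd (s-k-k-identity hsk hi) (k-app hkx) hzx)
      (k-app hky) hw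

  -- The projections: ⟨x,y⟩ k = x and ⟨x,y⟩ (k i) = i y = y.
  pair-fst : ∀ {p} → IsPair 𝒜 x y p → App p k x
  pair-fst {x} pr =
    let (kx , hkx , _) = k-ax x x
    in pair-app pr hkx (k-app hkx)

  pair-snd : ∀ {sk i ki p} → App s k sk → App sk k i → App k i ki →
             IsPair 𝒜 x y p → App p ki y
  pair-snd hsk hi hki pr = pair-app pr (k-app hki) (s-k-k-identity hsk hi)

  pair-injective : ∀ {x′ y′ p} → IsPair 𝒜 x y p → IsPair 𝒜 x′ y′ p →
                   x ≡ x′ × y ≡ y′
  pair-injective pr pr′ =
    let (_ , i , hsk , hi) = s-def k k
        (_ , hki , _) = k-ax i i
    in functional (pair-fst pr) (pair-fst pr′) ,
       functional (pair-snd hsk hi hki pr) (pair-snd hsk hi hki pr′)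

  -- The element f = s (k c) k with c = s d satisfies f y ≃ c (k y) = s d (k y);
  -- it is total since s d (k y) is always defined.
  s-kc-k-total : ∀ {d c kc skc f} → App s d c → App k c kc →
                 App s kc skc → App skc k f → ∀ y → _↓[_] 𝒜 f y
  s-kc-k-total {d} hc hkc hskc hf y =
    let (ky , hky , _) = k-ax y y
        (_ , v , hc′ , hv) = s-def d ky
    in v , s-app hskc hf (k-app hkc) hky (subst (λ q → App q ky v) (functional hc′ hc) hv)

  s-kc-k-inv : ∀ {d c kc skc f p} → App s d c → App k c kc →
               App s kc skc → App skc k f → App f y p →
               ∃[ ky ] (App k y ky × App c ky p)
  s-kc-k-inv hc hkc hskc hf h =
    let (c′ , ky , hc′ , hky , hp) = s-inv hskc hf h
    in ky , hky , subst (λ q → App q ky _) (functional hc′ (k-app hkc)) hp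

  -- Pairing with a fixed first component x is computable by a total element:
  -- take d = s i (k x) = λ*z. z x in the construction above, so f y = ⟨x,y⟩.
  pairing-realiser : ∀ x → ∃[ f ] ((∀ y → _↓[_] 𝒜 f y) ×
                                   (∀ y p → App f y p → IsPair 𝒜 x y p))
  pairing-realiser x =
    let (_ , i , hsk , hi) = s-def k k
        (kx , hkx , _) = k-ax x x
        (_ , d , hsi , hd) = s-def i kx
        (c , _ , hc , _) = s-def d d
        (kc , hkc , _) = k-ax c c
        (_ , f , hskc , hf) = s-def kc k
    in f , s-kc-k-total hc hkc hskc hf ,
       λ y p h → let (_ , hky , hp) = s-kc-k-inv hc hkc hskc hf h
                 in pair-eval hsk hi hsi hkx hd hc hky hp

  ce≤mH : (A : Carrier → Set) → CE 𝒜 A → _≤m_ 𝒜 A (H 𝒜)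
  ce≤mH A (e , A⇔e↓) =
    let (f , f-total , f-pairs) = pairing-realiser e
    in f , f-total , λ a p hp →
         let pr = f-pairs a p hp
         in mk⇔ (λ a∈A → e , a , pr , to (A⇔e↓ a) a∈A)
                (λ { (e′ , a′ , pr′ , e′a′↓) →
                       let (e≡e′ , a≡a′) = pair-injective pr pr′
                       in from (A⇔e↓ a) (subst₂ (_↓[_] 𝒜) (sym e≡e′) (sym a≡a′) e′a′↓) })

proposition5p3 : (𝒜 : PCA) (A : PCA.Carrier 𝒜 → Set) → CE 𝒜 A → _≤m_ 𝒜 A (H 𝒜)
proposition5p3 𝒜 = Reduction.ce≤mH 𝒜
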